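{- Let $G$ be a shifted graph on vertex set $[n]$ such that the maximum number of edges of a linear forest contained in $G$ as a subgraph is exactly $k-1$. Then $G$ is a subgraph of $H(n,k,m)$ for some integer $m$ with $\lceil\frac{k+1}{2}\rceil\le m\le k$.
   Context: A linear forest is a graph whose connected components are all paths or isolated vertices. For a graph $G$ on $[n]$ (edges viewed as 2-subsets) and $1\le i<j\le n$, the shifting operation $S_{ij}$ on an edge $e\in E(G)$ is $S_{ij}(e)=(e\setminus\{j\})\cup\{i\}$ if $j\in e$, $i\notin e$ and $(e\setminus\{j\})\cup\{i\}\notin E(G)$, and $S_{ij}(e)=e$ otherwise; $S_{ij}(G)$ is the graph on $[n]$ with edge set $\{S_{ij}(e):e\in E(G)\}$. $G$ is called shifted if $S_{ij}(G)=G$ for all $1\le i<j\le n$. For $\lceil\frac{k+1}{2}\rceil\le m\le k$, $H(n,k,m)$ is the graph on $[n]$ defined as follows: with $A=[m]$, $B=[n]\setminus A$ and $C=[k-m]\subseteq A$, its edges are all pairs inside $A$ together with all pairs $\{b,c\}$ with $b\in B$, $c\in C$. -}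

module Defs where

open import Data.Nat using (ℕ; zero; suc; _+_; _∸_; _≤_; _<_; ⌈_/2⌉)
open import Data.Fin using (Fin; toℕ; _≟_)
import Data.Fin as F
open import Data.Bool using (Bool; true; false; if_then_else_)
open import Data.Product using (Σ; ∃; ∃-syntax; _×_; _,_)
open import Data.List using (List; []; _∷_; length; concat; map)
open import Data.Nat.ListAction using (sum)
open import Data.Sum using (_⊎_)
open import Data.List.Relation.Unary.All using (All)
open import Data.List.Relation.Unary.Unique.Propositional using (Unique)
open import Relation.Binary.PropositionalEquality using (_≡_; _≢_)
open import Relation.Nullary using (¬_; yes; no)

-- A (finite simple) graph on the vertex set [n]; vertex v : Fin n stands
-- for the element (toℕ v + 1) of [n].
record Graph (n : ℕ) : Set where
  field
    adj   : Fin n → Fin n → Bool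
    sym   : ∀ x y → adj x y ≡ adj y x
    irref : ∀ x → adj x x ≡ false
open Graph public

Edge : ∀ {n} → Graph n → Fin n → Fin n → Set
Edge G x y = adj G x y ≡ true

-- The shifting operation S_ij applied to the edge {x,y} (given as an
-- ordered pair; the definition is symmetric in x,y for a symmetric graph):
-- replace j by i, provided i is not in the edge and the new edge is absent.
shiftPair : ∀ {n} → Graph n → Fin n → Fin n → Fin n → Fin n → Fin n × Fin n
shiftPair G i j x y with y ≟ j | x ≟ j
... | yes _ | _ with x ≟ i
...   | yes _ = (x , y)
...   | no _  = if adj G x i then (x , y) else (x , i)
shiftPair G i j x y | no _ | yes _ with y ≟ i
...   | yes _ = (x , y)
...   | no _  = if adj G i y then (x , y) else (i , y)
shiftPair G i j x y | no _ | no _ = (x , y)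

ShiftEdge : ∀ {n} → Graph n → Fin n → Fin n → Fin n → Fin n → Set
ShiftEdge G i j u v = ∃[ x ] ∃[ y ] (Edge G x y × shiftPair G i j x y ≡ (u , v))

Shifted : ∀ {n} → Graph n → Set
Shifted {n} G = ∀ (i j : Fin n) → i F.< j → ∀ u v →
  (ShiftEdge G i j u v → Edge G u v) × (Edge G u v → ShiftEdge G i j u v)

data IsPath {n} (G : Graph n) : List (Fin n) → Set where
  single : ∀ x → IsPath G (x ∷ [])
  cons   : ∀ x y {p} → Edge G x y → IsPath G (y ∷ p) → IsPath G (x ∷ y ∷ p)

record LinearForest {n} (G : Graph n) : Set where
  field
    paths    : List (List (Fin n))
    arePaths : All (IsPath G) paths
    disjoint : Unique (concat paths)
open LinearForest public

lfEdges : ∀ {n} {G : Graph n} → LinearForest G → ℕ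
lfEdges F = sum (map (λ p → length p ∸ 1) (paths F))

MaxLinearForestEdges : ∀ {n} → Graph n → ℕ → Set
MaxLinearForestEdges G e =
  (Σ (LinearForest G) λ F → lfEdges F ≡ e) × (∀ (F : LinearForest G) → lfEdges F ≤ e)

-- H(n,k,m): A = [m], B = [n] \ A, C = [k-m];
-- edges: all pairs inside A, and all pairs {b,c} with b ∈ B, c ∈ C.
HEdge : (n k m : ℕ) → Fin n → Fin n → Set
HEdge n k m x y =
  x ≢ y ×
  ( (toℕ x < m × toℕ y < m)
  ⊎ ((¬ toℕ x < m × toℕ y < k ∸ m) ⊎ (¬ toℕ y < m × toℕ x < k ∸ m)))

SubgraphOfH : ∀ {n} → Graph n → ℕ → ℕ → Set
SubgraphOfH {n} G k m = ∀ x y → Edge G x y → HEdge n k m x y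

module Submission where

-- Vertices are labelled 0,…,n−1 (vertex i stands for i+1 ∈ [n]).  For a level
-- t, call an edge xy with x < y a *far edge at level t* if t ≤ x and k − t ≤ y.
--
-- (1) Without any hypothesis on G: if G has no far edge at a level t ≤ k, then
--     every edge xy (x < y) has y < k − t or x < t, i.e. G ⊆ H(n,k,m) for
--     m = k − t; and when 2t < k this m satisfies ⌈(k+1)/2⌉ ≤ m ≤ k.
-- (2) For shifted G an edge uv may be replaced by uw for any w < v, w ≠ u.
--     Hence, if G has a far edge at every level t with 2t < k, shifting moves
--     them to all "cross" edges {a,b} with a + b = k, and then to all cross
--     edges with a + b = k − 1.  These form the zigzag path k,0,k−1,1,k−2,…
--     through the labels 0,…,k, a linear forest with k edges.
--
-- The theorem follows: the maximum k − 1 rules out the alternative in (2), so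
-- some level t with 2t < k carries no far edge, and (1) applies.

open import Defs
open import Data.Nat
  using (ℕ; zero; suc; pred; z<s; _+_; _∸_; _≤_; _<_; s≤s; ⌈_/2⌉; _<?_; _≤?_)
open import Data.Nat.Properties
  using ( ≤-refl; ≤-trans; <-trans; ≤-<-trans; <⇒≤; <⇒≢; <-cmp; ≮⇒≥; n<1+n; +-suc; +-comm
        ; +-identityʳ; m≤m+n; m≤n+m; m⊓n≤n; m≤n⇒m⊓n≡m; m≤n⇒m<n∨m≡n; m+n∸m≡n
        ; m∸[m∸n]≡n; m∸n≤m; m+n≤o⇒m≤o∸n; ⌊n/2⌋<n; 1+n≰n; +-monoʳ-<; +-monoʳ-≤
        ; n≤1+n; m<m+n)
open import Data.Fin using (Fin; toℕ; _≟_)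
import Data.Fin as F
import Data.Fin.Properties as FP
open import Data.Bool using (true; false)
import Data.Bool.Properties as BP
open import Data.Product using (Σ; ∃-syntax; _×_; _,_; proj₁)
open import Data.Sum using (_⊎_; inj₁; inj₂)
open import Data.Empty using (⊥-elim)
open import Data.List using (List; []; _∷_; length; map)
open import Data.List.Properties using (length-map; map-∘; map-id-local; ++-identityʳ)
open import Data.List.Relation.Unary.All as All using (All; []; _∷_)
open import Data.List.Relation.Unary.AllPairs using ([]; _∷_)
open import Data.List.Relation.Unary.Linked as Linked using (Linked; [-]; _∷_)
open import Data.List.Relation.Unary.Unique.Propositional using (Unique)
open import Data.List.Relation.Unary.Unique.Propositional.Properties as Unique using ()
open import Relation.Binary using (tri<; tri≈; tri>)
open import Relation.Binary.PropositionalEquality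
  using (_≡_; _≢_; refl; trans; cong; cong₂; subst; subst₂) renaming (sym to ≡-sym)
open import Relation.Nullary using (¬_; Dec; yes; no; ¬?)
open import Relation.Nullary.Decidable using (_×-dec_; decidable-stable)

module _ {n} (G : Graph n) where

  edge-sym : ∀ {x y} → Edge G x y → Edge G y x
  edge-sym {x} {y} e = trans (Graph.sym G y x) e

  edge-distinct : ∀ {x y} → Edge G x y → x ≢ y
  edge-distinct {x} e refl with () ← trans (≡-sym e) (Graph.irref G x)

module _ {n} {G : Graph n} (shifted : Shifted G) where

  shift-to-absent : ∀ {u v w} → u ≢ w → adj G u w ≡ false → shiftPair G w v u v ≡ (u , w)
  shift-to-absent {u} {v} {w} u≢w uw-absent with v ≟ v | u ≟ v
  ... | no v≢v | _ = ⊥-elim (v≢v refl)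
  ... | yes _  | _ with u ≟ w
  ...   | yes u≡w = ⊥-elim (u≢w u≡w)
  ...   | no _ rewrite uw-absent = refl

  lower-end : ∀ {u v w} → Edge G u v → w F.< v → w ≢ u → Edge G u w
  lower-end {u} {v} {w} uv w<v w≢u with adj G u w in uw
  ... | true  = refl
  ... | false = trans (≡-sym uw)
      (proj₁ (shifted w v w<v u w) (u , v , uv , shift-to-absent {v = v} (λ u≡w → w≢u (≡-sym u≡w)) uw))

  lower-end≤ : ∀ {u v w} → Edge G u v → toℕ w ≤ toℕ v → w ≢ u → Edge G u w
  lower-end≤ {u} uv w≤v w≢u with m≤n⇒m<n∨m≡n w≤v
  ... | inj₁ w<v = lower-end uv w<v w≢u
  ... | inj₂ w≡v = subst (Edge G u) (≡-sym (FP.toℕ-injective w≡v)) uv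

FarEdge : ∀ {n} → Graph n → ℕ → ℕ → Set
FarEdge {n} G k t =
  Σ (Fin n) λ x → Σ (Fin n) λ y → Edge G x y × toℕ x < toℕ y × t ≤ toℕ x × k ∸ t ≤ toℕ y

farEdge? : ∀ {n} (G : Graph n) k t → Dec (FarEdge G k t)
farEdge? G k t = FP.any? λ x → FP.any? λ y →
  (adj G x y BP.≟ true) ×-dec (toℕ x <? toℕ y) ×-dec (t ≤? toℕ x) ×-dec (k ∸ t ≤? toℕ y)

farEdge-dichotomy : ∀ {n} (G : Graph n) k →
  (∀ t → t + t < k → FarEdge G k t) ⊎ (∃[ t ] t + t < k × ¬ FarEdge G k t)
farEdge-dichotomy G k
  with FP.any? (λ (i : Fin k) → (toℕ i + toℕ i <? k) ×-dec ¬? (farEdge? G k (toℕ i)))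
... | yes (i , gap) = inj₂ (toℕ i , gap)
... | no no-gap = inj₁ λ t 2t<k → decidable-stable (farEdge? G k t) λ no-far →
        let t<k = ≤-<-trans (m≤m+n t t) 2t<k in
        no-gap (F.fromℕ< t<k ,
                subst (λ s → s + s < k × ¬ FarEdge G k s) (≡-sym (FP.toℕ-fromℕ< t<k)) (2t<k , no-far))

InH : ℕ → ℕ → ℕ → ℕ → Set
InH k m a b = (a < m × b < m) ⊎ ((¬ a < m × b < k ∸ m) ⊎ (¬ b < m × a < k ∸ m))

-- The pattern is symmetric, so it suffices to treat edges xy with x < y.
InH-sym : ∀ {k m a b} → InH k m a b → InH k m b a
InH-sym (inj₁ (a<m , b<m)) = inj₁ (b<m , a<m)
InH-sym (inj₂ (inj₁ ab))   = inj₂ (inj₂ ab)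
InH-sym (inj₂ (inj₂ ba))   = inj₂ (inj₁ ba)

noFarEdge⇒inH : ∀ {n} (G : Graph n) {k t} → t ≤ k → ¬ FarEdge G k t →
  ∀ {x y} → Edge G x y → toℕ x < toℕ y → InH k (k ∸ t) (toℕ x) (toℕ y)
noFarEdge⇒inH G {k} {t} t≤k no-far {x} {y} xy x<y with toℕ y <? k ∸ t
... | yes y<m = inj₁ (<-trans x<y y<m , y<m)
... | no y≮m with toℕ x <? t
...   | yes x<t = inj₂ (inj₂ (y≮m , subst (toℕ x <_) (≡-sym (m∸[m∸n]≡n t≤k)) x<t))
...   | no x≮t = ⊥-elim (no-far (x , y , xy , x<y , ≮⇒≥ x≮t , ≮⇒≥ y≮m))

noFarEdge⇒⊆H : ∀ {n} (G : Graph n) {k t} → t ≤ k → ¬ FarEdge G k t → SubgraphOfH G k (k ∸ t)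
noFarEdge⇒⊆H G t≤k no-far x y xy with <-cmp (toℕ x) (toℕ y)
... | tri< x<y _ _ = edge-distinct G xy , noFarEdge⇒inH G t≤k no-far xy x<y
... | tri≈ _ x≡y _ = ⊥-elim (edge-distinct G xy (FP.toℕ-injective x≡y))
... | tri> _ _ y<x = edge-distinct G xy , InH-sym (noFarEdge⇒inH G t≤k no-far (edge-sym G xy) y<x)

half-bound : ∀ k t → t + t < suc k → t + ⌈ suc (suc k) /2⌉ ≤ suc k
half-bound k zero _ = ⌊n/2⌋<n k
half-bound (suc zero) (suc t) (s≤s (s≤s 2t+1≤0)) with () ← subst (_≤ 0) (+-suc t t) 2t+1≤0
half-bound (suc (suc k)) (suc t) (s≤s (s≤s 2t+1≤k)) =
  s≤s (subst (_≤ suc (suc k)) (≡-sym (+-suc t _))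
              (s≤s (half-bound k t (subst (_≤ suc k) (+-suc t t) 2t+1≤k))))

level-bound : ∀ k t → t + t < suc k → ⌈ suc k + 1 /2⌉ ≤ suc k ∸ t
level-bound k t 2t<k = subst (λ c → ⌈ suc c /2⌉ ≤ suc k ∸ t) (+-comm 1 k)
  (m+n≤o⇒m≤o∸n _ (subst (_≤ suc k) (+-comm t _) (half-bound k t 2t<k)))

Cross : ∀ {n} → Graph n → ℕ → Set
Cross {n} G c = ∀ (x y : Fin n) → toℕ x < toℕ y → toℕ x + toℕ y ≡ c → Edge G x y

module _ {n} {G : Graph n} (shifted : Shifted G) where

  -- A far edge x′y′ at level t = x, with x + y = k, shifts down to xy:
  -- first lower x′ to x, then y′ to y = k − x.
  farEdges⇒cross : ∀ {k} → (∀ t → t + t < k → FarEdge G k t) → Cross G k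
  farEdges⇒cross {k} far x y x<y x+y≡k
    with far (toℕ x) (subst (toℕ x + toℕ x <_) x+y≡k (+-monoʳ-< (toℕ x) x<y))
  ... | x′ , y′ , x′y′ , x′<y′ , x≤x′ , k-x≤y′ =
    lower-end≤ shifted (edge-sym G (lower-end≤ shifted (edge-sym G x′y′) x≤x′ x≢y′)) y≤y′ y≢x
    where
      x≢y′ : x ≢ y′
      x≢y′ x≡y′ = <⇒≢ (≤-<-trans x≤x′ x′<y′) (cong toℕ x≡y′)
      y≢x : y ≢ x
      y≢x y≡x = <⇒≢ x<y (cong toℕ (≡-sym y≡x))
      y≤y′ : toℕ y ≤ toℕ y′
      y≤y′ = subst (_≤ toℕ y′) (trans (cong (_∸ toℕ x) (≡-sym x+y≡k)) (m+n∸m≡n (toℕ x) (toℕ y))) k-x≤y′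

  -- Cross edges of sum c + 1 shift down to those of sum c (lower y + 1 to y).
  cross-pred : ∀ {c} → suc c < n → Cross G (suc c) → Cross G c
  cross-pred {c} c+1<n cross x y x<y x+y≡c =
    lower-end shifted (cross x y⁺ (<-trans x<y y<y⁺) x+y⁺≡c+1) y<y⁺ y≢x
    where
      y⁺ : Fin n
      y⁺ = F.fromℕ< (≤-<-trans (s≤s (subst (toℕ y ≤_) x+y≡c (m≤n+m (toℕ y) (toℕ x)))) c+1<n)
      y⁺≡y+1 : toℕ y⁺ ≡ suc (toℕ y)
      y⁺≡y+1 = FP.toℕ-fromℕ< _
      y<y⁺ : toℕ y < toℕ y⁺
      y<y⁺ = subst (toℕ y <_) (≡-sym y⁺≡y+1) (n<1+n (toℕ y))
      x+y⁺≡c+1 : toℕ x + toℕ y⁺ ≡ suc c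
      x+y⁺≡c+1 = trans (cong (toℕ x +_) y⁺≡y+1) (trans (+-suc (toℕ x) (toℕ y)) (cong suc x+y≡c))
      y≢x : y ≢ x
      y≢x y≡x = <⇒≢ x<y (cong toℕ (≡-sym y≡x))

zigzag-down : ℕ → ℕ → List ℕ
zigzag-up   : ℕ → ℕ → List ℕ
zigzag-down lo zero    = lo + zero ∷ []
zigzag-down lo (suc d) = lo + suc d ∷ zigzag-up lo d
zigzag-up lo zero      = lo ∷ []
zigzag-up lo (suc d)   = lo ∷ zigzag-down (suc lo) d

length-zigzag-down : ∀ lo d → length (zigzag-down lo d) ≡ suc d
length-zigzag-up   : ∀ lo d → length (zigzag-up lo d) ≡ suc d
length-zigzag-down lo zero    = refl
length-zigzag-down lo (suc d) = cong suc (length-zigzag-up lo d)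
length-zigzag-up lo zero      = refl
length-zigzag-up lo (suc d)   = cong suc (length-zigzag-down (suc lo) d)

Within : ℕ → ℕ → ℕ → Set
Within lo hi v = lo ≤ v × v ≤ hi

zigzag-down-within : ∀ lo d → All (Within lo (lo + d)) (zigzag-down lo d)
zigzag-up-within   : ∀ lo d → All (Within lo (lo + d)) (zigzag-up lo d)
zigzag-down-within lo zero    = (m≤m+n lo zero , ≤-refl) ∷ []
zigzag-down-within lo (suc d) =
  (m≤m+n lo (suc d) , ≤-refl)
  ∷ All.map (λ { (lo≤v , v≤) → lo≤v , ≤-trans v≤ (+-monoʳ-≤ lo (n≤1+n d)) }) (zigzag-up-within lo d)
zigzag-up-within lo zero      = (≤-refl , m≤m+n lo zero) ∷ []
zigzag-up-within lo (suc d)   =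
  (≤-refl , m≤m+n lo (suc d))
  ∷ All.map (λ { {v} (lo<v , v≤) → <⇒≤ lo<v , subst (v ≤_) (≡-sym (+-suc lo d)) v≤ })
            (zigzag-down-within (suc lo) d)

-- The head of each zigzag lies strictly beyond the interval its tail covers.
zigzag-down-unique : ∀ lo d → Unique (zigzag-down lo d)
zigzag-up-unique   : ∀ lo d → Unique (zigzag-up lo d)
zigzag-down-unique lo zero    = [] ∷ []
zigzag-down-unique lo (suc d) =
  All.map (λ { (_ , v≤) top≡v → <⇒≢ (≤-<-trans v≤ (+-monoʳ-< lo (n<1+n d))) (≡-sym top≡v) })
          (zigzag-up-within lo d)
  ∷ zigzag-up-unique lo d
zigzag-up-unique lo zero      = [] ∷ []
zigzag-up-unique lo (suc d)   =
  All.map (λ { (lo<v , _) → <⇒≢ lo<v }) (zigzag-down-within (suc lo) d)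
  ∷ zigzag-down-unique (suc lo) d

-- Consecutive entries of a zigzag of [lo, hi] with lo + hi = k: a step down
-- across a cross pair of sum k, or a step up across one of sum k − 1.
ZigStep : ℕ → ℕ → ℕ → Set
ZigStep k a b = (b < a × b + a ≡ k) ⊎ (a < b × suc (a + b) ≡ k)

-- The two kinds of step, with the sums phrased as the zigzag invariants give them.
zigstep-down : ∀ {k} lo d → lo + (lo + suc d) ≡ k → ZigStep k (lo + suc d) lo
zigstep-down lo d sum = inj₁ (m<m+n lo z<s , sum)

up-sum : ∀ {k} lo d → suc (lo + (lo + suc d)) ≡ k → suc lo + (suc lo + d) ≡ k
up-sum lo d sum = trans (cong (λ z → suc (lo + z)) (≡-sym (+-suc lo d))) sum

zigstep-up : ∀ {k} lo d → suc (lo + (lo + suc d)) ≡ k → ZigStep k lo (suc lo + d)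
zigstep-up lo d sum = inj₂ (m≤m+n (suc lo) d , up-sum lo d sum)

linked-zigzag-down : ∀ {k} lo d → lo + (lo + d) ≡ k → Linked (ZigStep k) (zigzag-down lo d)
linked-zigzag-up   : ∀ {k} lo d → suc (lo + (lo + d)) ≡ k → Linked (ZigStep k) (zigzag-up lo d)
linked-zigzag-down lo zero _            = [-]
linked-zigzag-down lo (suc zero) sum    = zigstep-down lo zero sum ∷ [-]
linked-zigzag-down lo (suc (suc d)) sum =
  zigstep-down lo (suc d) sum
  ∷ linked-zigzag-up lo (suc d) (trans (≡-sym (trans (cong (lo +_) (+-suc lo (suc d))) (+-suc lo _))) sum)
linked-zigzag-up lo zero _              = [-]
linked-zigzag-up lo (suc zero) sum      = zigstep-up lo zero sum ∷ [-]
linked-zigzag-up lo (suc (suc d)) sum   =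
  zigstep-up lo (suc d) sum ∷ linked-zigzag-down (suc lo) (suc d) (up-sum lo (suc d) sum)

-- The vertex with label a (clamped to the last vertex when a > n′).
vertex : ∀ {n′} → ℕ → Fin (suc n′)
vertex {n′} a = F.fromℕ< (s≤s (m⊓n≤n a n′))

toℕ-vertex : ∀ {n′ a} → a ≤ n′ → toℕ (vertex {n′} a) ≡ a
toℕ-vertex a≤n′ = trans (FP.toℕ-fromℕ< _) (m≤n⇒m⊓n≡m a≤n′)

unique-vertices : ∀ {n′ xs} → All (_≤ n′) xs → Unique xs → Unique (map (vertex {n′}) xs)
unique-vertices {xs = xs} in-range distinct = Unique.map⁻ {f = toℕ}
  (subst Unique (≡-sym (trans (≡-sym (map-∘ xs)) (map-id-local (All.map toℕ-vertex in-range)))) distinct)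

module _ {n} (G : Graph n) where

  linked⇒path : ∀ {A : Set} (f : A → Fin n) {xs} →
    Linked (λ a b → Edge G (f a) (f b)) xs → 0 < length xs → IsPath G (map f xs)
  linked⇒path f [-]      _ = single _
  linked⇒path f (e ∷ es) _ = cons _ _ e (linked⇒path f es z<s)

  path-forest : ∀ {p} → IsPath G p → Unique p → Σ (LinearForest G) λ F → lfEdges F ≡ length p ∸ 1
  path-forest {p} path distinct =
    record { paths = p ∷ [] ; arePaths = path ∷ [] ; disjoint = subst Unique (≡-sym (++-identityʳ p)) distinct }
    , +-identityʳ _

module _ {n′} {G : Graph (suc n′)} {k} (k≤n′ : k ≤ n′) (crossₖ : Cross G k) (crossₖ₋₁ : Cross G (pred k)) where

  cross-vertices : ∀ {c a b} → Cross G c → a < b → a + b ≡ c → b ≤ n′ → Edge G (vertex a) (vertex b)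
  cross-vertices cross a<b a+b≡c b≤n′ =
    cross _ _ (subst₂ _<_ (≡-sym a-label) (≡-sym b-label) a<b) (trans (cong₂ _+_ a-label b-label) a+b≡c)
    where
      a-label = toℕ-vertex (≤-trans (<⇒≤ a<b) b≤n′)
      b-label = toℕ-vertex b≤n′

  zigstep⇒edge : ∀ {a b} → ZigStep k a b → Edge G (vertex a) (vertex b)
  zigstep⇒edge {a} {b} (inj₁ (b<a , b+a≡k)) =
    edge-sym G (cross-vertices crossₖ b<a b+a≡k (≤-trans (subst (a ≤_) b+a≡k (m≤n+m a b)) k≤n′))
  zigstep⇒edge {a} {b} (inj₂ (a<b , a+b+1≡k)) =
    cross-vertices crossₖ₋₁ a<b (cong pred a+b+1≡k)
      (≤-trans (subst (b ≤_) a+b+1≡k (≤-trans (m≤n+m b a) (n≤1+n _))) k≤n′)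

  zigzag-forest : Σ (LinearForest G) λ F → lfEdges F ≡ k
  zigzag-forest with path-forest G
      (linked⇒path G vertex (Linked.map zigstep⇒edge (linked-zigzag-down 0 k refl))
                   (subst (0 <_) (≡-sym (length-zigzag-down 0 k)) z<s))
      (unique-vertices (All.map (λ { (_ , v≤k) → ≤-trans v≤k k≤n′ }) (zigzag-down-within 0 k))
                       (zigzag-down-unique 0 k))
  ... | F , size = F , trans size (cong (_∸ 1) (trans (length-map vertex (zigzag-down 0 k)) (length-zigzag-down 0 k)))

farEdges⇒forest : ∀ {n} {G : Graph n} {k} → Shifted G → 0 < k →
  (∀ t → t + t < k → FarEdge G k t) → Σ (LinearForest G) λ F → lfEdges F ≡ k
farEdges⇒forest {zero} _ k>0 far with () ← far 0 k>0
farEdges⇒forest {suc n′} {G} {suc k} shifted _ far =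
  zigzag-forest k<n crossₖ (cross-pred shifted (s≤s k<n) crossₖ)
  where
    crossₖ : Cross G (suc k)
    crossₖ = farEdges⇒cross shifted far
    -- The far edge at level 0 reaches label k.
    k<n : suc k ≤ n′
    k<n with far 0 z<s
    ... | _ , y , _ , _ , _ , k≤y = ≤-trans k≤y (FP.toℕ≤pred[n] y)

lemma3p1 : (n k : ℕ) (G : Graph n) → 1 ≤ k → Shifted G → MaxLinearForestEdges G (k ∸ 1) →
           Σ ℕ (λ m → (⌈ (k + 1) /2⌉ ≤ m) × (m ≤ k) × SubgraphOfH G k m)
lemma3p1 n (suc k) G _ shifted (_ , maximal) with farEdge-dichotomy G (suc k)
... | inj₁ far with farEdges⇒forest shifted z<s far
...   | F , size = ⊥-elim (1+n≰n (subst (_≤ k) size (maximal F)))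
lemma3p1 n (suc k) G _ shifted (_ , maximal) | inj₂ (t , 2t<k , no-far) =
  suc k ∸ t , level-bound k t 2t<k , m∸n≤m (suc k) t
  , noFarEdge⇒⊆H G (<⇒≤ (≤-<-trans (m≤m+n t t) 2t<k)) no-far
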